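{- For every graph $G=(V,E)$ and positive integer $f$, the output subgraph $H$ of the algorithm FTGreedyMFDCertificate$(G,f)$ is an $f$-MFD connectivity certificate of $G$.
   Context: For $F\subseteq V\cup E$, $G-F$ is the graph obtained by deleting the vertices in $F\cap V$ (with their incident edges) and the edges in $F\cap E$. For $v\in V$ let $\deg_G(v,F)=|\{u\in N_G(v): u\in F\text{ or }\{u,v\}\in F\}|$ and $\deg_G(F)=\max_{v\in V\setminus F}\deg_G(v,F)$. A set $F$ damages an edge $e$ if $e$ is not an edge of $G-F$. Algorithm FTGreedyMFDCertificate$(G,f)$: fix an ordering $e_1,\dots,e_m$ of $E$ with $e_i=\{u_i,v_i\}$; start with $H=(V,\emptyset)$; for $i=1,\dots,m$, if there exists $F\subseteq V\cup E$ with $\deg_G(F)\le f$ that does not damage $e_i$ and such that $u_i,v_i$ are disconnected in (the current) $H-F$, add $e_i$ to $H$; return $H$. A subgraph $H\subseteq G$ is an $f$-MFD connectivity certificate of $G$ if for every $F\subseteq V\cup E$ with $\deg_G(F)\le f$, the graphs $G-F$ and $H-F$ have the same connected components. -}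

module Defs where

open import Data.Nat using (ℕ; zero; suc; _≤_; _+_)
open import Data.Fin using (Fin) renaming (_≟_ to _≟ᶠ_)
open import Data.Bool using (Bool; true; false; _∧_; _∨_; not; if_then_else_)
open import Data.List using (List; []; _∷_; _++_; [_]; map; allFin)
open import Data.Bool.ListAction using (any)
open import Data.Nat.ListAction using (sum)
open import Data.List.Relation.Unary.All using (All)
open import Data.List.Relation.Unary.Any using (Any)
open import Data.List.Relation.Unary.AllPairs using (AllPairs)
open import Data.Product using (Σ; _×_; _,_; proj₁; proj₂)
open import Data.Sum using (_⊎_)
open import Relation.Binary.PropositionalEquality using (_≡_; _≢_)
open import Relation.Nullary using (¬_; does)

-- Vertex set V = Fin n.  An (undirected) edge {u,v} is written as a pair (u , v);
-- the pairs (u , v) and (v , u) denote the same edge.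
Edge : ℕ → Set
Edge n = Fin n × Fin n

SameEdge : ∀ {n} → Edge n → Edge n → Set
SameEdge (a , b) (c , d) = (a ≡ c × b ≡ d) ⊎ (a ≡ d × b ≡ c)

sameEdgeᵇ : ∀ {n} → Edge n → Edge n → Bool
sameEdgeᵇ (a , b) (c , d) =
  (does (a ≟ᶠ c) ∧ does (b ≟ᶠ d)) ∨ (does (a ≟ᶠ d) ∧ does (b ≟ᶠ c))

-- A finite simple graph on Fin n, given by a list of its edges; the list is
-- the fixed ordering e₁,…,e_m of E used by the algorithm.
IsSimpleEdgeList : ∀ {n} → List (Edge n) → Set
IsSimpleEdgeList es =
  All (λ e → proj₁ e ≢ proj₂ e) es × AllPairs (λ e e′ → ¬ SameEdge e e′) es

Adj : ∀ {n} → List (Edge n) → Fin n → Fin n → Set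
Adj es u v = Any (SameEdge (u , v)) es

adjᵇ : ∀ {n} → List (Edge n) → Fin n → Fin n → Bool
adjᵇ es u v = any (sameEdgeᵇ (u , v)) es

-- A set F ⊆ V ∪ E: its vertex part fv and edge part fe; the edge {u,v}
-- belongs to F iff fe u v or fe v u.
record Fault (n : ℕ) : Set where
  field
    fv : Fin n → Bool
    fe : Fin n → Fin n → Bool
open Fault public

inFE : ∀ {n} → Fault n → Fin n → Fin n → Bool
inFE F u v = fe F u v ∨ fe F v u

FaultOf : ∀ {n} → List (Edge n) → Fault n → Set
FaultOf es F = ∀ u v → inFE F u v ≡ true → Adj es u v

degAt : ∀ {n} → List (Edge n) → Fault n → Fin n → ℕ
degAt {n} es F v =
  sum (map (λ u → if adjᵇ es v u ∧ (fv F u ∨ inFE F u v) then 1 else 0) (allFin n))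

DegBounded : ∀ {n} → List (Edge n) → Fault n → ℕ → Set
DegBounded es F f = ∀ v → fv F v ≡ false → degAt es F v ≤ f

Survives : ∀ {n} → Fault n → Fin n → Fin n → Set
Survives F u v = fv F u ≡ false × fv F v ≡ false × inFE F u v ≡ false

Damages : ∀ {n} → Fault n → Edge n → Set
Damages F (u , v) = ¬ Survives F u v

data Reach {n} (es : List (Edge n)) (F : Fault n) (u : Fin n) : Fin n → Set where
  here : fv F u ≡ false → Reach es F u u
  step : ∀ {w x} → Reach es F u w → Adj es w x → Survives F w x → Reach es F u x

GreedyCond : ∀ {n} → List (Edge n) → ℕ → List (Edge n) → Edge n → Set
GreedyCond G f H (u , v) =
  Σ (Fault _) λ F → FaultOf G F × DegBounded G F f × ¬ Damages F (u , v)
                    × ¬ Reach H F u v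

-- GreedyRun G f rest H H′ : processing the remaining edges `rest` (in order)
-- starting from the current edge set H, the algorithm ends with H′.
data GreedyRun {n} (G : List (Edge n)) (f : ℕ) :
       List (Edge n) → List (Edge n) → List (Edge n) → Set where
  done : ∀ {H} → GreedyRun G f [] H H
  add  : ∀ {e rest H H′} → GreedyCond G f H e →
         GreedyRun G f rest (H ++ [ e ]) H′ → GreedyRun G f (e ∷ rest) H H′
  skip : ∀ {e rest H H′} → ¬ GreedyCond G f H e →
         GreedyRun G f rest H H′ → GreedyRun G f (e ∷ rest) H H′

FTGreedyMFDCertificate : ∀ {n} → List (Edge n) → ℕ → List (Edge n) → Set
FTGreedyMFDCertificate G f H = GreedyRun G f G [] H

IsMFDCertificate : ∀ {n} → List (Edge n) → ℕ → List (Edge n) → Set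
IsMFDCertificate G f H =
  (∀ {u v} → Adj H u v → Adj G u v) ×
  (∀ (F : Fault _) → FaultOf G F → DegBounded G F f →
     ∀ u v → (Reach G F u v → Reach H F u v) × (Reach H F u v → Reach G F u v))

{-# OPTIONS --safe #-}
-- An edge {a,b} of G is skipped by the greedy algorithm only if no admissible
-- fault F sparing it separates a from b in the current H − F; as H only grows,
-- every edge of G − F is then bridged by a path of the final H − F, for every
-- admissible F.  Together with H ⊆ G this gives equal components.  Turning "no separating F"
-- into an actual path needs reachability to be decidable, which follows by
-- induction on the edge list: a path in (e ∷ es) − F either avoids e or joins
-- both of its ends to an end of e in es − F.
module Submission where

open import Defs
open import Data.Nat using (ℕ; _≤_)
open import Data.List using (List; []; _∷_; _++_; [_])
open import Data.List.Properties using (++-assoc)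
open import Data.List.Relation.Unary.Any using (here; there)
open import Data.List.Membership.Propositional using (_∈_; find; lose)
open import Data.List.Relation.Binary.Subset.Propositional using (_⊆_)
open import Data.List.Relation.Binary.Subset.Propositional.Properties
  using (⊆-refl; ⊆-trans; ++⁺ʳ; xs⊆x∷xs)
open import Data.List.Membership.Propositional.Properties using (∈-++⁺ˡ; ∈-++⁺ʳ)
open import Data.Fin using (Fin) renaming (_≟_ to _≟ᶠ_)
open import Data.Bool using (false)
open import Data.Bool.Properties using (∨-comm) renaming (_≟_ to _≟ᵇ_)
open import Data.Product using (_×_; _,_; proj₁; proj₂)
open import Data.Sum using (_⊎_; inj₁; inj₂; [_,_]′) renaming (map to ⊎-map)
open import Function using (_∘_)
open import Data.Empty using (⊥-elim)
open import Relation.Binary.PropositionalEquality using (_≡_; refl; trans; subst)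
open import Relation.Nullary using (Dec; yes; no)
open import Relation.Nullary.Decidable using (_×-dec_; _⊎-dec_; map′)

private
  variable
    n : ℕ
    F : Fault n
    es A B : List (Edge n)
    a b u w x : Fin n

sameEdge-swap : ∀ (e : Edge n) → SameEdge (a , b) e → SameEdge (b , a) e
sameEdge-swap e (inj₁ (p , q)) = inj₂ (q , p)
sameEdge-swap e (inj₂ (p , q)) = inj₁ (q , p)

adj-sym : Adj es a b → Adj es b a
adj-sym = Data.List.Relation.Unary.Any.map (λ {e} → sameEdge-swap e)

inFE-sym : ∀ (F : Fault n) a b → inFE F a b ≡ inFE F b a
inFE-sym F a b = ∨-comm (fe F a b) (fe F b a)

survives-sym : ∀ (F : Fault n) → Survives F a b → Survives F b a
survives-sym {a = a} {b = b} F (p , q , r) = q , p , trans (inFE-sym F b a) r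

survives? : ∀ (F : Fault n) a b → Dec (Survives F a b)
survives? F a b =
  (fv F a ≟ᵇ false) ×-dec ((fv F b ≟ᵇ false) ×-dec (inFE F a b ≟ᵇ false))

reach-edge : Adj es a b → Survives F a b → Reach es F a b
reach-edge adj s = step (here (proj₁ s)) adj s

reach-trans : Reach es F u w → Reach es F w x → Reach es F u x
reach-trans r (here _) = r
reach-trans r (step r′ adj s) = step (reach-trans r r′) adj s

reach-sym : Reach es F u x → Reach es F x u
reach-sym (here p) = here p
reach-sym {F = F} (step r adj s) =
  reach-trans (reach-edge (adj-sym adj) (survives-sym F s)) (reach-sym r)

adj-mono : A ⊆ B → Adj A a b → Adj B a b
adj-mono A⊆B adj with find adj
... | e , e∈A , same = lose (A⊆B e∈A) same

reach-mono : A ⊆ B → Reach A F u x → Reach B F u x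
reach-mono A⊆B (here p) = here p
reach-mono A⊆B (step r adj s) = step (reach-mono A⊆B r) (adj-mono A⊆B adj) s

reach-bridged : (∀ {a b} → (a , b) ∈ A → Survives F a b → Reach B F a b) →
                Reach A F u x → Reach B F u x
reach-bridged bridge (here p) = here p
reach-bridged {F = F} bridge (step r adj s) with find adj
... | _ , e∈A , inj₁ (refl , refl) =
  reach-trans (reach-bridged bridge r) (bridge e∈A s)
... | _ , e∈A , inj₂ (refl , refl) =
  reach-trans (reach-bridged bridge r) (reach-sym (bridge e∈A (survives-sym F s)))

reach-[]⁻ : Reach [] F u x → fv F u ≡ false × u ≡ x
reach-[]⁻ (here p) = p , refl
reach-[]⁻ (step _ () _)

Touches : List (Edge n) → Fault n → Fin n → Edge n → Set
Touches es F u (a , b) = Reach es F u a ⊎ Reach es F u b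

Via : List (Edge n) → Fault n → Fin n → Fin n → Edge n → Set
Via es F u x (a , b) = Survives F a b × Touches es F u (a , b) × Touches es F x (a , b)

reach-∷⁻ : Reach ((a , b) ∷ es) F u x → Reach es F u x ⊎ Via es F u x (a , b)
reach-∷⁻ (here p) = inj₁ (here p)
reach-∷⁻ (step r (there adj) s) =
  ⊎-map (λ r′ → step r′ adj s)
        (λ (sab , tu , tw) → sab , tu , ⊎-map (reach-trans x→w) (reach-trans x→w) tw)
        (reach-∷⁻ r)
  where x→w = reach-sym (reach-edge adj s)
reach-∷⁻ (step r (here (inj₁ (refl , refl))) s) =
  inj₂ (s , [ inj₁ , proj₁ ∘ proj₂ ]′ (reach-∷⁻ r) ,
        inj₂ (here (proj₁ (proj₂ s))))
reach-∷⁻ {F = F} (step r (here (inj₂ (refl , refl))) s) =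
  inj₂ (survives-sym F s , [ inj₂ , proj₁ ∘ proj₂ ]′ (reach-∷⁻ r) ,
        inj₁ (here (proj₁ (proj₂ s))))

reach-∷⁺ : Reach es F u x ⊎ Via es F u x (a , b) → Reach ((a , b) ∷ es) F u x
reach-∷⁺ {es = es} (inj₁ r) = reach-mono (xs⊆x∷xs es _) r
reach-∷⁺ {es = es} {F = F} {a = a} {b = b} (inj₂ (s , tu , tx)) =
  reach-trans (to-a tu) (reach-sym (to-a tx))
  where
  to-a : ∀ {v} → Touches es F v (a , b) → Reach ((a , b) ∷ es) F v a
  to-a = [ reach-mono (xs⊆x∷xs es _)
         , (λ r → reach-trans (reach-mono (xs⊆x∷xs es _) r)
                              (reach-sym (reach-edge (here (inj₁ (refl , refl))) s))) ]′

reach? : ∀ (es : List (Edge n)) F u x → Dec (Reach es F u x)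
reach? [] F u x =
  map′ (λ { (p , refl) → here p }) reach-[]⁻ ((fv F u ≟ᵇ false) ×-dec (u ≟ᶠ x))
reach? ((a , b) ∷ es) F u x =
  map′ reach-∷⁺ reach-∷⁻
       (reach? es F u x ⊎-dec (survives? F a b ×-dec (touches? u ×-dec touches? x)))
  where
  touches? : ∀ v → Dec (Touches es F v (a , b))
  touches? v = reach? es F v a ⊎-dec reach? es F v b

Bridges : List (Edge n) → ℕ → List (Edge n) → Edge n → Set
Bridges G f H (a , b) = ∀ (F : Fault _) → FaultOf G F → DegBounded G F f →
                        Survives F a b → Reach H F a b

module _ {G : List (Edge n)} {f : ℕ} where

  run-grows : ∀ {rest H H′} → GreedyRun G f rest H H′ → H ⊆ H′
  run-grows done = ⊆-refl
  run-grows (add _ run) = ⊆-trans ∈-++⁺ˡ (run-grows run)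
  run-grows (skip _ run) = run-grows run

  run-output⊆ : ∀ {rest H H′} → GreedyRun G f rest H H′ → H′ ⊆ H ++ rest
  run-output⊆ done = ∈-++⁺ˡ
  run-output⊆ {rest = e ∷ rest} {H = H} (add _ run) =
    subst (λ xs → _ ⊆ xs) (++-assoc H [ e ] rest) (run-output⊆ run)
  run-output⊆ {rest = e ∷ rest} {H = H} (skip _ run) =
    ⊆-trans (run-output⊆ run) (++⁺ʳ H (xs⊆x∷xs rest e))

  run-bridges : ∀ {rest H H′} → GreedyRun G f rest H H′ →
                ∀ {e} → e ∈ rest → Bridges G f H′ e
  run-bridges (add _ run) (there e∈) = run-bridges run e∈
  run-bridges (skip _ run) (there e∈) = run-bridges run e∈
  run-bridges {H = H} (add _ run) (here refl) F _ _ s =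
    reach-edge (adj-mono (run-grows run) e∈H′) s
    where e∈H′ = lose (∈-++⁺ʳ H (here refl)) (inj₁ (refl , refl))
  run-bridges {H = H} (skip {e = a , b} skipped run) (here refl) F fo db s
    with reach? H F a b
  ... | yes r = reach-mono (run-grows run) r
  ... | no ¬r = ⊥-elim (skipped (F , fo , db , (λ damaged → damaged s) , ¬r))

mainTheorem5 : (n : ℕ) (G : List (Edge n)) → IsSimpleEdgeList G →
    (f : ℕ) → 1 ≤ f → (H : List (Edge n)) →
    FTGreedyMFDCertificate G f H → IsMFDCertificate G f H
mainTheorem5 n G _ f _ H run =
  adj-mono H⊆G ,
  λ F fo db u v →
    reach-bridged (λ e∈G → run-bridges run e∈G F fo db) , reach-mono H⊆G
  where
  H⊆G : H ⊆ G
  H⊆G = run-output⊆ run
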